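{- For an odd integer $m$ let $\xi(m)=-2\sin(m\pi/6)$, and for a positive integer $n$ let \[ E_1(n;4)=\#\{d>0: d\mid n,\ d\equiv 1 \pmod 4\} - \#\{d>0: d\mid n,\ d\equiv -1 \pmod 4\}. \] Let $n$ be a positive integer not divisible by $3$. Then \[ \sum_{d\mid n,\ d\ \mathrm{odd}} \xi(d) = -E_1(n;4)\quad\text{and}\quad \sum_{d\mid n,\ d\ \mathrm{odd}} \xi(3d) = -2E_1(n;4), \] where the sums run over the positive odd divisors $d$ of $n$. -}

module Defs where

open import Data.Nat using (ℕ; zero; suc; _%_; _*_)
open import Data.Nat.Divisibility using (_∣?_)
open import Data.Nat.Properties using (_≟_)
open import Data.List using (List; filter; map; upTo; length; foldr)
open import Data.Integer using (ℤ; +_; -_; _-_; _+_; 0ℤ)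
open import Function using (_∘_)

-- Sign-table of  -2 sin(r π / 6)  for a residue r mod 12 (r odd);
-- sin(π/6)=1/2, sin(π/2)=1, sin(5π/6)=1/2, sin(7π/6)=-1/2, sin(3π/2)=-1, sin(11π/6)=-1/2.
ξ12 : ℕ → ℤ
ξ12 1  = - (+ 1)
ξ12 3  = - (+ 2)
ξ12 5  = - (+ 1)
ξ12 7  = + 1
ξ12 9  = + 2
ξ12 11 = + 1
ξ12 _  = 0ℤ

-- ξ(m) = -2 sin(mπ/6) for odd positive m (sin is 2π-periodic, so only m mod 12 matters).
-- Only ever applied to odd arguments below.
ξ : ℕ → ℤ
ξ m = ξ12 (m % 12)

divisors : ℕ → List ℕ
divisors n = filter (_∣? n) (map suc (upTo n))

oddDivisors : ℕ → List ℕ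
oddDivisors n = filter (λ d → d % 2 ≟ 1) (divisors n)

sumℤ : List ℤ → ℤ
sumℤ = foldr _+_ 0ℤ

E₁₄ : ℕ → ℤ
E₁₄ n = + length (filter (λ d → d % 4 ≟ 1) (divisors n))
      - + length (filter (λ d → d % 4 ≟ 3) (divisors n))

{-# OPTIONS --safe #-}
module Submission where

-- Let χ₄ be the non-principal character mod 4. Both ξ and χ₄ have period 12, and on the
-- residues prime to 3 one checks ξ(d) = -χ₄(d) and ξ(3d) = -2χ₄(d). As χ₄ vanishes on even
-- numbers, summing it over the odd divisors of n is summing it over all divisors, which
-- counts those ≡ 1 minus those ≡ 3 mod 4, i.e. gives E₁(n;4).

open import Defs
open import Data.Nat using (ℕ; NonZero; _*_)
open import Data.Nat.Divisibility using (_∣_)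
open import Data.Integer using (-_) renaming (_*_ to _*ℤ_)
open import Data.Integer using (+_)
open import Data.List using (map)
open import Data.Product using (_×_)
open import Relation.Nullary using (¬_)
open import Relation.Binary.PropositionalEquality using (_≡_)

open import Level using (Level)
open import Data.Bool using (true; false; if_then_else_)
open import Data.Nat using (suc; _%_; _<_; allUpTo?)
open import Data.Nat.Divisibility using (_∤_; _∣?_; divides; ∣-trans; ∣n∣m%n⇒∣m)
open import Data.Nat.DivMod using (m%n<n; m%n%n≡m%n; %-distribˡ-*; m∣n⇒o%n%m≡o%m)
open import Data.Nat.Properties using (_≟_)
open import Data.Integer using (ℤ; 0ℤ; -1ℤ; _+_; _-_) renaming (_≟_ to _≟ℤ_)
open import Data.Integer.Properties using (+-identityˡ; *-zeroʳ; *-distribˡ-+; -1*i≡-i; neg-distribˡ-*)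
open import Data.Integer.Tactic.RingSolver using (solve-∀)
open import Data.List using ([]; _∷_; filter; length; upTo)
open import Data.List.Properties using (map-cong-local)
open import Data.List.Relation.Unary.All as All using (All)
open import Data.List.Relation.Unary.All.Properties using (all-filter; filter⁺)
open import Data.Product using (_,_; proj₁; proj₂)
open import Function using (_∘_)
open import Relation.Nullary using (Dec; yes; no; does; ¬?; _×-dec_; _→-dec_; toWitness)
open import Relation.Unary using (Pred; Decidable)
open import Relation.Binary.PropositionalEquality using (refl; sym; trans; cong; cong₂; subst₂; module ≡-Reasoning)

open ≡-Reasoning

private variable
  a p : Level
  A : Set a

𝟙 : {P : Set p} → Dec P → ℤ
𝟙 P? = if does P? then + 1 else 0ℤ

sumℤ-map-*ˡ : ∀ k (f : A → ℤ) xs → sumℤ (map (λ x → k *ℤ f x) xs) ≡ k *ℤ sumℤ (map f xs)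
sumℤ-map-*ˡ k f []       = sym (*-zeroʳ k)
sumℤ-map-*ˡ k f (x ∷ xs) = begin
  k *ℤ f x + sumℤ (map (λ x → k *ℤ f x) xs) ≡⟨ cong (_+_ (k *ℤ f x)) (sumℤ-map-*ˡ k f xs) ⟩
  k *ℤ f x + k *ℤ sumℤ (map f xs)           ≡⟨ *-distribˡ-+ k (f x) _ ⟨
  k *ℤ (f x + sumℤ (map f xs))              ∎

sumℤ-map-minus : ∀ (f g : A → ℤ) xs →
  sumℤ (map (λ x → f x - g x) xs) ≡ sumℤ (map f xs) - sumℤ (map g xs)
sumℤ-map-minus f g []       = refl
sumℤ-map-minus f g (x ∷ xs) = begin
  (f x - g x) + sumℤ (map (λ x → f x - g x) xs)    ≡⟨ cong (_+_ (f x - g x)) (sumℤ-map-minus f g xs) ⟩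
  (f x - g x) + (sumℤ (map f xs) - sumℤ (map g xs)) ≡⟨ rearrange (f x) (g x) _ _ ⟩
  (f x + sumℤ (map f xs)) - (g x + sumℤ (map g xs)) ∎
  where
  rearrange : ∀ a b c d → (a - b) + (c - d) ≡ (a + c) - (b + d)
  rearrange = solve-∀

module _ {P : Pred A p} (P? : Decidable P) where

  sumℤ-map-𝟙 : ∀ xs → sumℤ (map (𝟙 ∘ P?) xs) ≡ + length (filter P? xs)
  sumℤ-map-𝟙 []       = refl
  sumℤ-map-𝟙 (x ∷ xs) with does (P? x)
  ... | true  = cong (_+_ (+ 1)) (sumℤ-map-𝟙 xs)
  ... | false = trans (+-identityˡ _) (sumℤ-map-𝟙 xs)

  sumℤ-map-filter : ∀ (f : A → ℤ) → (∀ {x} → ¬ P x → f x ≡ 0ℤ) → ∀ xs →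
    sumℤ (map f (filter P? xs)) ≡ sumℤ (map f xs)
  sumℤ-map-filter f f≡0 []       = refl
  sumℤ-map-filter f f≡0 (x ∷ xs) with P? x
  ... | yes _  = cong (_+_ (f x)) (sumℤ-map-filter f f≡0 xs)
  ... | no ¬Px = begin
    sumℤ (map f (filter P? xs)) ≡⟨ sumℤ-map-filter f f≡0 xs ⟩
    sumℤ (map f xs)             ≡⟨ +-identityˡ _ ⟨
    0ℤ + sumℤ (map f xs)        ≡⟨ cong (_+ sumℤ (map f xs)) (f≡0 ¬Px) ⟨
    f x + sumℤ (map f xs)       ∎

χ₄ : ℕ → ℤ
χ₄ d = 𝟙 (d % 4 ≟ 1) - 𝟙 (d % 4 ≟ 3)

χ₄-mod : ∀ d n .{{_ : NonZero n}} → 4 ∣ n → χ₄ (d % n) ≡ χ₄ d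
χ₄-mod d n 4∣n = cong (λ r → 𝟙 (r ≟ 1) - 𝟙 (r ≟ 3)) (m∣n⇒o%n%m≡o%m 4 n d 4∣n)

even⇒χ₄≡0 : ∀ d → ¬ (d % 2 ≡ 1) → χ₄ d ≡ 0ℤ
even⇒χ₄≡0 d d-even = begin
  χ₄ d       ≡⟨ χ₄-mod d 4 (divides 1 refl) ⟨
  χ₄ (d % 4) ≡⟨ residues (m%n<n d 4) (d-even ∘ trans (sym (m∣n⇒o%n%m≡o%m 2 4 d (divides 2 refl)))) ⟩
  0ℤ         ∎
  where
  residues : ∀ {r} → r < 4 → ¬ (r % 2 ≡ 1) → χ₄ r ≡ 0ℤ
  residues = toWitness {a? = allUpTo? (λ r → ¬? (r % 2 ≟ 1) →-dec χ₄ r ≟ℤ 0ℤ) 4} _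

sumℤ-map-χ₄ : ∀ xs → sumℤ (map χ₄ xs) ≡
  + length (filter (λ d → d % 4 ≟ 1) xs) - + length (filter (λ d → d % 4 ≟ 3) xs)
sumℤ-map-χ₄ xs = trans (sumℤ-map-minus _ _ xs) (cong₂ _-_ (sumℤ-map-𝟙 _ xs) (sumℤ-map-𝟙 _ xs))

sumℤ-map-χ₄-oddDivisors : ∀ n → sumℤ (map χ₄ (oddDivisors n)) ≡ E₁₄ n
sumℤ-map-χ₄-oddDivisors n =
  trans (sumℤ-map-filter (λ d → d % 2 ≟ 1) χ₄ (λ {d} → even⇒χ₄≡0 d) (divisors n))
        (sumℤ-map-χ₄ (divisors n))

ξ-mod-12 : ∀ m → ξ (m % 12) ≡ ξ m
ξ-mod-12 m = cong ξ12 (m%n%n≡m%n m 12)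

ξ-3*-mod-12 : ∀ d → ξ (3 * (d % 12)) ≡ ξ (3 * d)
ξ-3*-mod-12 d = cong ξ12 (sym (%-distribˡ-* 3 d 12))

ξ-via-χ₄-residue : ∀ {r} → r < 12 → 3 ∤ r →
  ξ r ≡ -1ℤ *ℤ χ₄ r × ξ (3 * r) ≡ - (+ 2) *ℤ χ₄ r
ξ-via-χ₄-residue = toWitness {a? = allUpTo? (λ r → ¬? (3 ∣? r) →-dec
  (ξ r ≟ℤ -1ℤ *ℤ χ₄ r ×-dec ξ (3 * r) ≟ℤ - (+ 2) *ℤ χ₄ r)) 12} _

ξ-via-χ₄ : ∀ d → 3 ∤ d → ξ d ≡ -1ℤ *ℤ χ₄ d × ξ (3 * d) ≡ - (+ 2) *ℤ χ₄ d
ξ-via-χ₄ d 3∤d =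
    transfer -1ℤ (ξ-mod-12 d) (proj₁ at-residue)
  , transfer (- (+ 2)) (ξ-3*-mod-12 d) (proj₂ at-residue)
  where
  r : ℕ
  r = d % 12

  at-residue : ξ r ≡ -1ℤ *ℤ χ₄ r × ξ (3 * r) ≡ - (+ 2) *ℤ χ₄ r
  at-residue = ξ-via-χ₄-residue (m%n<n d 12) (3∤d ∘ ∣n∣m%n⇒∣m (divides 4 refl))

  transfer : ∀ k {x y} → x ≡ y → x ≡ k *ℤ χ₄ r → y ≡ k *ℤ χ₄ d
  transfer k x≡y = subst₂ (λ x c → x ≡ k *ℤ c) x≡y (χ₄-mod d 12 (divides 3 refl))

lemma2p1 : (n : ℕ) → NonZero n → ¬ (3 ∣ n) →
    (sumℤ (map ξ (oddDivisors n)) ≡ - E₁₄ n)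
    × (sumℤ (map (λ d → ξ (3 * d)) (oddDivisors n)) ≡ - ((+ 2) *ℤ E₁₄ n))
lemma2p1 n _ 3∤n =
    trans (sum-over-oddDivisors -1ℤ (proj₁ ∘ ξ-via-χ₄ _)) (-1*i≡-i (E₁₄ n))
  , trans (sum-over-oddDivisors (- (+ 2)) (proj₂ ∘ ξ-via-χ₄ _)) (sym (neg-distribˡ-* (+ 2) (E₁₄ n)))
  where
  oddDivisors-3∤ : All (3 ∤_) (oddDivisors n)
  oddDivisors-3∤ = filter⁺ (λ d → d % 2 ≟ 1)
    (All.map (λ d∣n 3∣d → 3∤n (∣-trans 3∣d d∣n)) (all-filter (_∣? n) (map suc (upTo n))))

  sum-over-oddDivisors : ∀ {f : ℕ → ℤ} k → (∀ {d} → 3 ∤ d → f d ≡ k *ℤ χ₄ d) →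
    sumℤ (map f (oddDivisors n)) ≡ k *ℤ E₁₄ n
  sum-over-oddDivisors {f} k f≡kχ₄ = begin
    sumℤ (map f (oddDivisors n))                   ≡⟨ cong sumℤ (map-cong-local (All.map f≡kχ₄ oddDivisors-3∤)) ⟩
    sumℤ (map (λ d → k *ℤ χ₄ d) (oddDivisors n))   ≡⟨ sumℤ-map-*ˡ k χ₄ (oddDivisors n) ⟩
    k *ℤ sumℤ (map χ₄ (oddDivisors n))             ≡⟨ cong (_*ℤ_ k) (sumℤ-map-χ₄-oddDivisors n) ⟩
    k *ℤ E₁₄ n                                     ∎
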